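{- Let $n=2$, $\mathsf{AP}_L=\{i\}$, $\mathsf{AP}^O=\{o\}$, $\mathcal{I}=2^{\{i\}\times\{0,1\}}$ and $\mathcal{O}=2^{\{o\}\times\{0,1\}}$. The set of all computation trees $\langle \mathcal{I}^*,\tau\rangle$, $\tau:\mathcal{I}^*\to\mathcal{O}$, that have the symmetry property is not a regular tree language.
   Context: For $u\subseteq \mathsf{AP}\times\{0,1\}$ and $k\in\mathbb{Z}$, $\mathrm{rot}(u,k)=\{(p,(j+k)\bmod 2)\mid (p,j)\in u\}$ (extended letterwise to words); thus $\mathrm{rot}(\cdot,1)$ swaps the indices $0$ and $1$. A computation tree $\langle \mathcal{I}^*,\tau\rangle$ has the symmetry property if $\tau(\mathrm{rot}(t,k))=\mathrm{rot}(\tau(t),k)$ for all $t\in\mathcal{I}^*$ and $k\in\{0,1\}$. A tree language (a set of $\mathcal{O}$-labelled full $\mathcal{I}$-branching trees) is regular if it is recognized by some finite tree automaton (with a Muller acceptance condition). -}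

module Defs where

open import Data.Bool using (Bool; true; false)
open import Data.Nat using (ℕ; zero; suc; _≥_)
open import Data.Fin using (Fin)
open import Data.Fin.Subset using (Subset; _∈_)
open import Data.List using (List; []; _∷_; _∷ʳ_)
open import Data.Product using (_×_; _,_; ∃; ∃-syntax; Σ-syntax)
open import Function.Bundles using (_⇔_)
open import Relation.Binary.PropositionalEquality using (_≡_)
open import Relation.Nullary using (¬_)

-- A letter u ⊆ {p} × {0,1} for a single proposition p is represented by the
-- pair of booleans ((p,0) ∈ u , (p,1) ∈ u).
-- ℐ = 2^({i}×{0,1})  and  𝒪 = 2^({o}×{0,1}).
ℐ : Set
ℐ = Bool × Bool

𝒪 : Set
𝒪 = Bool × Bool

rot : Bool × Bool → Fin 2 → Bool × Bool
rot (a , b) Fin.zero = (a , b)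
rot (a , b) (Fin.suc Fin.zero) = (b , a)

rotW : List ℐ → Fin 2 → List ℐ
rotW [] k = []
rotW (u ∷ t) k = rot u k ∷ rotW t k

-- A computation tree ⟨ℐ*, τ⟩ is given by its labelling τ : ℐ* → 𝒪.
Tree : Set
Tree = List ℐ → 𝒪

Symmetric : Tree → Set
Symmetric τ = ∀ (t : List ℐ) (k : Fin 2) → τ (rotW t k) ≡ rot (τ t) k

record MullerTreeAutomaton : Set where
  field
    n     : ℕ
    q₀    : Fin n
    -- transition relation: δ q σ f = true iff f ∈ δ(q, σ), f assigning a state to each direction
    δ     : Fin n → 𝒪 → (ℐ → Fin n) → Bool
    table : Subset n → Bool

prefix : (ℕ → ℐ) → ℕ → List ℐ
prefix π zero = []
prefix π (suc m) = prefix π m ∷ʳ π m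

module _ (A : MullerTreeAutomaton) where
  open MullerTreeAutomaton A

  -- a run of A on τ; the d-child of node t is t·d
  IsRun : Tree → (List ℐ → Fin n) → Set
  IsRun τ r = (r [] ≡ q₀) × (∀ (t : List ℐ) → δ (r t) (τ t) (λ d → r (t ∷ʳ d)) ≡ true)

  InfOften : (List ℐ → Fin n) → (ℕ → ℐ) → Fin n → Set
  InfOften r π q = ∀ (m : ℕ) → ∃[ k ] (k ≥ m × r (prefix π k) ≡ q)

  IsAccepting : (List ℐ → Fin n) → Set
  IsAccepting r = ∀ (π : ℕ → ℐ) (S : Subset n) →
    (∀ (q : Fin n) → (q ∈ S) ⇔ InfOften r π q) → table S ≡ true

  Accepts : Tree → Set
  Accepts τ = ∃[ r ] (IsRun τ r × IsAccepting r)

RegularTreeLanguage : (Tree → Set) → Set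
RegularTreeLanguage L = Σ[ A ∈ MullerTreeAutomaton ] (∀ (τ : Tree) → Accepts A τ ⇔ L τ)

module Submission where

-- The proof is a pigeonhole argument on a family of symmetric trees.
--
-- For each m, the tree `echo m` labels every node d·w with |w| = m by its
-- first direction d and all other nodes by ∅; it is symmetric.  Suppose a
-- Muller automaton A with n states recognised the symmetric trees.  Among the
-- n + 1 trees echo 0, …, echo n, two (echo i and echo j with i ≠ j) have
-- accepting runs that are in the same state at the root's child d₁ = {(i,0)}.
-- Grafting the d₁-subtree of echo j (and of its run) into echo i yields an
-- accepting run of A on a tree that is not symmetric: the node d₁·∅ʲ is
-- labelled d₁, while its rotation rot(d₁,1)·∅ʲ lies in the part copied from
-- echo i and is labelled ∅.

open import Defs
open import Data.Bool using (true; false)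
import Data.Bool.Properties as Bool
open import Data.Empty using (⊥-elim)
open import Data.Nat using (ℕ; zero; suc; _≤_; s≤s; _⊔_; _≟_)
open import Data.Nat.Properties using (m≤m⊔n; m≤n⊔m; ≤-trans; <⇒≢; n<1+n)
open import Data.Fin using (Fin; toℕ)
open import Data.Fin.Properties using (pigeonhole)
open import Data.List using (List; []; _∷_; _∷ʳ_; length; replicate)
open import Data.List.Properties using (length-replicate)
open import Data.Product using (_×_; _,_; proj₁; ∃-syntax)
open import Data.Product.Properties using (≡-dec)
open import Function using (_∘_)
open import Function.Bundles using (mk⇔; Equivalence)
open import Relation.Binary.Definitions using (DecidableEquality)
open import Relation.Binary.PropositionalEquality
  using (_≡_; _≢_; refl; sym; trans; cong; cong₂; module ≡-Reasoning)
open import Relation.Nullary using (¬_; yes; no)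

_≟ℐ_ : DecidableEquality ℐ
_≟ℐ_ = ≡-dec Bool._≟_ Bool._≟_

∅ : 𝒪
∅ = (false , false)

-- The direction {(i,0)}; rot(·,1) moves it.
d₁ : ℐ
d₁ = (true , false)

graft : {X : Set} → ℐ → (List ℐ → X) → (List ℐ → X) → List ℐ → X
graft d f g [] = f []
graft d f g (x ∷ w) with x ≟ℐ d
... | yes _ = g (x ∷ w)
... | no _ = f (x ∷ w)

graft-here : {X : Set} {d x : ℐ} {f g : List ℐ → X} (w : List ℐ) →
  x ≡ d → graft d f g (x ∷ w) ≡ g (x ∷ w)
graft-here {d = d} {x} w x≡d with x ≟ℐ d
... | yes _ = refl
... | no x≢d = ⊥-elim (x≢d x≡d)

graft-elsewhere : {X : Set} {d x : ℐ} {f g : List ℐ → X} (w : List ℐ) →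
  x ≢ d → graft d f g (x ∷ w) ≡ f (x ∷ w)
graft-elsewhere {d = d} {x} w x≢d with x ≟ℐ d
... | yes x≡d = ⊥-elim (x≢d x≡d)
... | no _ = refl

-- A run is grafted this way, so that f's root transition still applies; at
-- the child d the two runs are assumed to agree anyway.
graftBelow : {X : Set} → ℐ → (List ℐ → X) → (List ℐ → X) → List ℐ → X
graftBelow d f g (x ∷ y ∷ w) = graft d f g (x ∷ y ∷ w)
graftBelow d f g w = f w

module _ (A : MullerTreeAutomaton) where
  open MullerTreeAutomaton A

  graft-run : (d : ℐ) (f g : Tree) (rf rg : List ℐ → Fin n) →
    IsRun A f rf → IsRun A g rg → rf (d ∷ []) ≡ rg (d ∷ []) →
    IsRun A (graft d f g) (graftBelow d rf rg)
  graft-run d f g rf rg (rf-root , rf-δ) (_ , rg-δ) same-at-d = rf-root , step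
    where
    step : ∀ t → δ (graftBelow d rf rg t) (graft d f g t)
                   (λ e → graftBelow d rf rg (t ∷ʳ e)) ≡ true
    step [] = rf-δ []
    step (x ∷ []) with x ≟ℐ d
    ... | yes refl rewrite same-at-d = rg-δ (d ∷ [])
    ... | no _ = rf-δ (x ∷ [])
    step (x ∷ y ∷ w) with x ≟ℐ d
    ... | yes _ = rg-δ (x ∷ y ∷ w)
    ... | no _ = rf-δ (x ∷ y ∷ w)

AgreeFrom : {X : Set} → ℕ → (List ℐ → X) → (List ℐ → X) → (ℕ → ℐ) → Set
AgreeFrom N r r′ π = ∀ k → N ≤ k → r (prefix π k) ≡ r′ (prefix π k)

prefix-suc : ∀ (π : ℕ → ℐ) m → prefix π (suc m) ≡ π 0 ∷ prefix (π ∘ suc) m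
prefix-suc π zero = refl
prefix-suc π (suc m) = cong (_∷ʳ π (suc m)) (prefix-suc π m)

prefix-suc-suc : ∀ (π : ℕ → ℐ) m →
  prefix π (suc (suc m)) ≡ π 0 ∷ π 1 ∷ prefix (π ∘ suc ∘ suc) m
prefix-suc-suc π m =
  trans (prefix-suc π (suc m)) (cong (π 0 ∷_) (prefix-suc (π ∘ suc) m))

graftBelow-follows-g : {X : Set} {d : ℐ} {f g : List ℐ → X} (π : ℕ → ℐ) →
  π 0 ≡ d → AgreeFrom 2 (graftBelow d f g) g π
graftBelow-follows-g π π₀≡d (suc (suc k)) (s≤s (s≤s _))
  rewrite prefix-suc-suc π k = graft-here _ π₀≡d

graftBelow-follows-f : {X : Set} {d : ℐ} {f g : List ℐ → X} (π : ℕ → ℐ) →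
  π 0 ≢ d → AgreeFrom 2 (graftBelow d f g) f π
graftBelow-follows-f π π₀≢d (suc (suc k)) (s≤s (s≤s _))
  rewrite prefix-suc-suc π k = graft-elsewhere _ π₀≢d

module _ (A : MullerTreeAutomaton) where
  open MullerTreeAutomaton A

  infOften-transfer : ∀ {N q} (r r′ : List ℐ → Fin n) (π : ℕ → ℐ) →
    AgreeFrom N r r′ π → InfOften A r π q → InfOften A r′ π q
  infOften-transfer {N} r r′ π agree inf m with inf (m ⊔ N)
  ... | k , m⊔N≤k , rk≡q =
    k , ≤-trans (m≤m⊔n m N) m⊔N≤k
      , trans (sym (agree k (≤-trans (m≤n⊔m m N) m⊔N≤k))) rk≡q

  accepting-by-branches : (r′ : List ℐ → Fin n) →
    (∀ π → ∃[ r ] (IsAccepting A r × ∃[ N ] AgreeFrom N r′ r π)) →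
    IsAccepting A r′
  accepting-by-branches r′ agreement π S S≡Inf
    with r , r-accepting , N , agree ← agreement π =
    r-accepting π S λ q → mk⇔
      (infOften-transfer r′ r π agree ∘ Equivalence.to (S≡Inf q))
      (Equivalence.from (S≡Inf q) ∘
         infOften-transfer r r′ π (λ k N≤k → sym (agree k N≤k)))

  graft-accepts : (d : ℐ) (f g : Tree) (ρf : Accepts A f) (ρg : Accepts A g) →
    proj₁ ρf (d ∷ []) ≡ proj₁ ρg (d ∷ []) → Accepts A (graft d f g)
  graft-accepts d f g (rf , rf-run , rf-acc) (rg , rg-run , rg-acc) same-at-d =
    graftBelow d rf rg , graft-run A d f g rf rg rf-run rg-run same-at-d
                       , accepting-by-branches (graftBelow d rf rg) follows
    where
    follows : ∀ π → ∃[ r ] (IsAccepting A r × ∃[ N ] AgreeFrom N (graftBelow d rf rg) r π)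
    follows π with π 0 ≟ℐ d
    ... | yes π₀≡d = rg , rg-acc , 2 , graftBelow-follows-g π π₀≡d
    ... | no π₀≢d = rf , rf-acc , 2 , graftBelow-follows-f π π₀≢d

echo : ℕ → Tree
echo m [] = ∅
echo m (u ∷ w) with length w ≟ m
... | yes _ = u
... | no _ = ∅

echo-at-depth : ∀ {m} u w → length w ≡ m → echo m (u ∷ w) ≡ u
echo-at-depth {m} u w |w|≡m with length w ≟ m
... | yes _ = refl
... | no |w|≢m = ⊥-elim (|w|≢m |w|≡m)

echo-off-depth : ∀ {m} u w → length w ≢ m → echo m (u ∷ w) ≡ ∅
echo-off-depth {m} u w |w|≢m with length w ≟ m
... | yes |w|≡m = ⊥-elim (|w|≢m |w|≡m)
... | no _ = refl

rot-∅ : ∀ k → rot ∅ k ≡ ∅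
rot-∅ Fin.zero = refl
rot-∅ (Fin.suc Fin.zero) = refl

length-rotW : ∀ t k → length (rotW t k) ≡ length t
length-rotW [] k = refl
length-rotW (u ∷ t) k = cong suc (length-rotW t k)

rotW-replicate-∅ : ∀ m k → rotW (replicate m ∅) k ≡ replicate m ∅
rotW-replicate-∅ zero k = refl
rotW-replicate-∅ (suc m) k = cong₂ _∷_ (rot-∅ k) (rotW-replicate-∅ m k)

-- echo m is symmetric: rotating a path rotates its first direction and keeps
-- its depth.
echo-symmetric : ∀ m → Symmetric (echo m)
echo-symmetric m [] k = sym (rot-∅ k)
echo-symmetric m (u ∷ w) k with length w ≟ m
... | yes |w|≡m = echo-at-depth (rot u k) (rotW w k) (trans (length-rotW w k) |w|≡m)
... | no |w|≢m =
  trans (echo-off-depth (rot u k) (rotW w k) (|w|≢m ∘ trans (sym (length-rotW w k))))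
        (sym (rot-∅ k))

-- Grafting the d₁-subtree of echo j into echo i breaks symmetry when i ≠ j:
-- d₁·∅ʲ is labelled d₁, but its rotation rot(d₁,1)·∅ʲ is labelled ∅.
graft-echo-asymmetric : ∀ {i j} → i ≢ j → ¬ Symmetric (graft d₁ (echo i) (echo j))
graft-echo-asymmetric {i} {j} i≢j symmetric = ∅≢rot-d₁ (begin
  ∅                  ≡⟨ sym at-rotated-node ⟩
  τ (rotW t swap)    ≡⟨ symmetric t swap ⟩
  rot (τ t) swap     ≡⟨ cong (λ o → rot o swap) at-node ⟩
  rot d₁ swap        ∎)
  where
  open ≡-Reasoning
  τ : Tree
  τ = graft d₁ (echo i) (echo j)
  swap : Fin 2
  swap = Fin.suc Fin.zero
  t : List ℐ
  t = d₁ ∷ replicate j ∅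
  ∅≢rot-d₁ : ∅ ≢ rot d₁ swap
  ∅≢rot-d₁ ()
  at-node : τ t ≡ d₁
  at-node = trans (graft-here {d = d₁} {f = echo i} {echo j} (replicate j ∅) refl)
                  (echo-at-depth d₁ (replicate j ∅) (length-replicate j))
  at-rotated-node : τ (rotW t swap) ≡ ∅
  at-rotated-node rewrite rotW-replicate-∅ j swap =
    trans (graft-elsewhere {d = d₁} {f = echo i} {echo j} (replicate j ∅) (λ ()))
          (echo-off-depth (rot d₁ swap) (replicate j ∅)
            (λ |w|≡i → i≢j (trans (sym |w|≡i) (length-replicate j))))

-- Pigeonhole on the state at d₁: an automaton accepting all echo m, m ≤ n,
-- accepts the graft of two distinct ones.
accepts-graft-of-echoes : (A : MullerTreeAutomaton) → (∀ m → Accepts A (echo m)) →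
  ∃[ i ] ∃[ j ] (i ≢ j × Accepts A (graft d₁ (echo i) (echo j)))
accepts-graft-of-echoes A echo-accepted =
  let i , j , i<j , same-state = pigeonhole (n<1+n n) state-at-d₁
  in toℕ i , toℕ j , <⇒≢ i<j
     , graft-accepts A d₁ _ _ (echo-accepted (toℕ i)) (echo-accepted (toℕ j)) same-state
  where
  open MullerTreeAutomaton A
  state-at-d₁ : Fin (suc n) → Fin n
  state-at-d₁ x = proj₁ (echo-accepted (toℕ x)) (d₁ ∷ [])

lemma6 : ¬ RegularTreeLanguage Symmetric
lemma6 (A , recognises) =
  let i , j , i≢j , graft-accepted = accepts-graft-of-echoes A echo-accepted
  in graft-echo-asymmetric i≢j (Equivalence.to (recognises _) graft-accepted)
  where
  echo-accepted : ∀ m → Accepts A (echo m)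
  echo-accepted m = Equivalence.from (recognises (echo m)) (echo-symmetric m)
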